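{- Let $G$ be a connected graph with $p$ vertices and $q$ edges such that $e(v_i)>1$ for every vertex $v_i$. Then $$W_\epsilon(G)\leq\frac{(p-1)\varepsilon^*(G)-\zeta(G)}{2},$$ with equality if and only if $\operatorname{diam}(G)=2$.
   Context: Graphs are finite, simple, undirected. For a connected graph $G$ with vertices $v_1,\ldots,v_p$, $d(v_i,v_j)$ is the distance, $e(v_i)=\max_j d(v_i,v_j)$ the eccentricity, and $\deg(v_i)$ the degree. The eccentricity matrix $\epsilon(G)$ has $(i,j)$ entry $d(v_i,v_j)$ if $d(v_i,v_j)=\min\{e(v_i),e(v_j)\}$ and $0$ otherwise. $W_\epsilon(G)=\frac12\sum_{i,j}(\epsilon(G))_{ij}$; $\varepsilon^*(G)=\sum_i e(v_i)$ is the total eccentricity; $\zeta(G)=\sum_i\deg(v_i)e(v_i)$ is the eccentric connectivity index. -}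

module Defs where

open import Data.Nat using (ℕ; zero; suc; _+_; _*_; _⊔_; _⊓_; _≡ᵇ_)
open import Data.Bool using (Bool; true; false; _∧_; _∨_; if_then_else_)
open import Data.Fin using (Fin; _≟_)
open import Data.Vec using (tabulate; foldr′)
open import Data.Product using (∃)
open import Relation.Nullary.Decidable using (⌊_⌋)
open import Relation.Binary.PropositionalEquality using (_≡_)

Σ[_] : ∀ {p} → (Fin p → ℕ) → ℕ
Σ[ f ] = foldr′ _+_ 0 (tabulate f)

Max[_] : ∀ {p} → (Fin p → ℕ) → ℕ
Max[ f ] = foldr′ _⊔_ 0 (tabulate f)

record Graph (p : ℕ) : Set where
  field
    adj   : Fin p → Fin p → Bool
    sym   : ∀ i j → adj i j ≡ adj j i
    irrefl : ∀ i → adj i i ≡ false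
open Graph public

module _ {p : ℕ} (G : Graph p) where

  walk : ℕ → Fin p → Fin p → Bool
  walk zero    i j = ⌊ i ≟ j ⌋
  walk (suc k) i j = walk k i j ∨ foldr′ _∨_ false (tabulate (λ m → walk k i m ∧ adj G m j))

  Connected : Set
  Connected = ∀ i j → ∃ λ k → walk k i j ≡ true

  -- least k < n with f k = true (n if none)
  search : ℕ → (ℕ → Bool) → ℕ
  search zero    f = 0
  search (suc n) f = if f 0 then 0 else suc (search n (λ k → f (suc k)))

  -- shortest-path distance (correct for connected graphs, where d < p)
  dist : Fin p → Fin p → ℕ
  dist i j = search p (λ k → walk k i j)

  ecc : Fin p → ℕ
  ecc i = Max[ (λ j → dist i j) ]

  deg : Fin p → ℕ
  deg i = Σ[ (λ j → if adj G i j then 1 else 0) ]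

  diam : ℕ
  diam = Max[ ecc ]

  εM : Fin p → Fin p → ℕ
  εM i j = if dist i j ≡ᵇ (ecc i ⊓ ecc j) then dist i j else 0

  -- 2 · W_ε(G) = sum of all entries of ε(G)
  twiceWε : ℕ
  twiceWε = Σ[ (λ i → Σ[ (λ j → εM i j) ]) ]

  totalEcc : ℕ
  totalEcc = Σ[ ecc ]

  ζ : ℕ
  ζ = Σ[ (λ i → deg i * ecc i) ]

-- Row i of ε(G) vanishes on the diagonal and, since every eccentricity exceeds 1, at the
-- neighbours of i; each of its other p − 1 − deg(i) entries is at most e(i). Summing over
-- the rows gives 2W_ε + ζ ≤ (p − 1)ε*. Equality forces ε(i,x) = e(i) for a vertex x at
-- distance 2 from i, which exists by connectivity, so every eccentricity is 2. Conversely,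
-- if every eccentricity is 2 then non-adjacent distinct vertices are at distance
-- 2 = min(e(i), e(j)), so every such entry equals e(i).
module Submission where

open import Defs hiding (sym)
open import Data.Nat using (ℕ; zero; suc; _+_; _*_; _∸_; _≤_; _<_; _⊓_; _≡ᵇ_; z≤n; s≤s; >-nonZero⁻¹)
open import Data.Nat.Properties
  using ( ≤-antisym; ≤-trans; ≤-reflexive; <⇒≤; n≮n; n≤0⇒n≡0; n≢0⇒n>0; n>0⇒n≢0; ≡ᵇ⇒≡; ≡⇒≡ᵇ
        ; +-identityʳ; *-identityʳ; +-mono-≤; +-monoˡ-≤; +-monoʳ-≤; +-cancelˡ-≡; +-cancelʳ-≤
        ; m≤m⊔n; m≤n⇒m≤o⊔n; ⊔-lub; ⊔-sel; m⊓n≤m; ⊓-glb; +-*-semiring; module ≤-Reasoning )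
open import Data.Bool using (Bool; true; false; _∧_; _∨_; if_then_else_; T)
open import Data.Unit using (tt)
open import Data.Bool.Properties using (∨-zeroʳ)
open import Data.Fin using (Fin; _≟_) renaming (zero to fz; suc to fs)
open import Data.Fin.Properties using (nonZeroIndex; suc-injective)
open import Data.Vec using (tabulate; foldr′)
open import Data.Product using (_×_; _,_; ∃)
open import Data.Sum using (_⊎_; inj₁; inj₂)
open import Function using (_∘_)
open import Function.Bundles using (_⇔_; mk⇔; Equivalence)
open import Relation.Nullary using (¬_; yes; no; contradiction)
open import Relation.Nullary.Decidable using (⌊_⌋; ⌊⌋-map′)
open import Relation.Binary.PropositionalEquality

open import Algebra.Properties.Semiring.Sum +-*-semiring
  using (sum; sum-cong-≗; ∑-distrib-+; *-distribˡ-sum; *-distribʳ-sum)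

Σ[]≡sum : ∀ {p} (f : Fin p → ℕ) → Σ[ f ] ≡ sum f
Σ[]≡sum {zero}  f = refl
Σ[]≡sum {suc p} f = cong (f fz +_) (Σ[]≡sum (f ∘ fs))

module _ {p : ℕ} where

  Σ-cong : {f g : Fin p → ℕ} → (∀ j → f j ≡ g j) → Σ[ f ] ≡ Σ[ g ]
  Σ-cong {f} {g} f≗g = begin
    Σ[ f ]  ≡⟨ Σ[]≡sum f ⟩
    sum f   ≡⟨ sum-cong-≗ f≗g ⟩
    sum g   ≡⟨ Σ[]≡sum g ⟨
    Σ[ g ]  ∎
    where open ≡-Reasoning

  Σ-distrib-+ : (f g : Fin p → ℕ) → Σ[ (λ j → f j + g j) ] ≡ Σ[ f ] + Σ[ g ]
  Σ-distrib-+ f g = begin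
    Σ[ (λ j → f j + g j) ]  ≡⟨ Σ[]≡sum (λ j → f j + g j) ⟩
    sum (λ j → f j + g j)   ≡⟨ ∑-distrib-+ f g ⟩
    sum f + sum g           ≡⟨ cong₂ _+_ (Σ[]≡sum f) (Σ[]≡sum g) ⟨
    Σ[ f ] + Σ[ g ]         ∎
    where open ≡-Reasoning

  *-distribˡ-Σ : ∀ c (f : Fin p → ℕ) → c * Σ[ f ] ≡ Σ[ (λ j → c * f j) ]
  *-distribˡ-Σ c f = begin
    c * Σ[ f ]              ≡⟨ cong (c *_) (Σ[]≡sum f) ⟩
    c * sum f               ≡⟨ *-distribˡ-sum c f ⟩
    sum (λ j → c * f j)     ≡⟨ Σ[]≡sum (λ j → c * f j) ⟨
    Σ[ (λ j → c * f j) ]    ∎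
    where open ≡-Reasoning

  *-distribʳ-Σ : ∀ c (f : Fin p → ℕ) → Σ[ f ] * c ≡ Σ[ (λ j → f j * c) ]
  *-distribʳ-Σ c f = begin
    Σ[ f ] * c              ≡⟨ cong (_* c) (Σ[]≡sum f) ⟩
    sum f * c               ≡⟨ *-distribʳ-sum c f ⟩
    sum (λ j → f j * c)     ≡⟨ Σ[]≡sum (λ j → f j * c) ⟨
    Σ[ (λ j → f j * c) ]    ∎
    where open ≡-Reasoning

Σ-mono-≤ : ∀ {p} {f g : Fin p → ℕ} → (∀ j → f j ≤ g j) → Σ[ f ] ≤ Σ[ g ]
Σ-mono-≤ {zero}  f≤g = z≤n
Σ-mono-≤ {suc p} f≤g = +-mono-≤ (f≤g fz) (Σ-mono-≤ (f≤g ∘ fs))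

+-rigid : ∀ {a b c d} → a ≤ c → b ≤ d → a + b ≡ c + d → a ≡ c × b ≡ d
+-rigid {a} {b} {c} {d} a≤c b≤d a+b≡c+d =
  a≡c , +-cancelˡ-≡ c b d (subst (λ x → x + b ≡ c + d) a≡c a+b≡c+d)
  where
  a≡c : a ≡ c
  a≡c = ≤-antisym a≤c (+-cancelʳ-≤ b c a (≤-trans (+-monoʳ-≤ c b≤d) (≤-reflexive (sym a+b≡c+d))))

Σ-rigid : ∀ {p} {f g : Fin p → ℕ} → (∀ j → f j ≤ g j) → Σ[ f ] ≡ Σ[ g ] → ∀ j → f j ≡ g j
Σ-rigid {suc p} f≤g Σf≡Σg j with +-rigid (f≤g fz) (Σ-mono-≤ (f≤g ∘ fs)) Σf≡Σg
Σ-rigid {suc p} f≤g Σf≡Σg fz     | f₀≡g₀ , _ = f₀≡g₀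
Σ-rigid {suc p} f≤g Σf≡Σg (fs j) | _ , Σf′≡Σg′ = Σ-rigid (f≤g ∘ fs) Σf′≡Σg′ j

Σ-const : ∀ {p} c → Σ[ (λ (_ : Fin p) → c) ] ≡ p * c
Σ-const {zero}  c = refl
Σ-const {suc p} c = cong (c +_) (Σ-const {p} c)

Σ-≢ : ∀ {p} (i : Fin p) → Σ[ (λ j → if ⌊ i ≟ j ⌋ then 0 else 1) ] ≡ p ∸ 1
Σ-≢ {suc p}       fz     = trans (Σ-const {p} 1) (*-identityʳ p)
Σ-≢ {suc (suc p)} (fs i) = cong suc (trans (Σ-cong ⌊fs≟fs⌋) (Σ-≢ i))
  where
  ⌊fs≟fs⌋ : ∀ j → (if ⌊ fs i ≟ fs j ⌋ then 0 else 1) ≡ (if ⌊ i ≟ j ⌋ then 0 else 1)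
  ⌊fs≟fs⌋ j = cong (λ b → if b then 0 else 1) (⌊⌋-map′ (cong fs) suc-injective (i ≟ j))

Max-ub : ∀ {p} (f : Fin p → ℕ) j → f j ≤ Max[ f ]
Max-ub f fz     = m≤m⊔n _ _
Max-ub f (fs j) = m≤n⇒m≤o⊔n (f fz) (Max-ub (f ∘ fs) j)

Max-lub : ∀ {p} {f : Fin p → ℕ} {c} → (∀ j → f j ≤ c) → Max[ f ] ≤ c
Max-lub {zero}  f≤c = z≤n
Max-lub {suc p} f≤c = ⊔-lub (f≤c fz) (Max-lub (f≤c ∘ fs))

<Max⇒∃< : ∀ {p} (f : Fin p → ℕ) {c} → c < Max[ f ] → ∃ λ j → c < f j
<Max⇒∃< {suc p} f {c} c<Max with ⊔-sel (f fz) (Max[ f ∘ fs ])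
... | inj₁ Max≡f₀ = fz , subst (c <_) Max≡f₀ c<Max
... | inj₂ Max≡Max′ with <Max⇒∃< (f ∘ fs) (subst (c <_) Max≡Max′ c<Max)
...   | j , c<fj = fs j , c<fj

Max≡⇔≡ : ∀ {n} {f : Fin (suc n) → ℕ} {c} → (∀ j → c ≤ f j) → (Max[ f ] ≡ c) ⇔ (∀ j → f j ≡ c)
Max≡⇔≡ {f = f} c≤f = mk⇔
  (λ Max≡c j → ≤-antisym (≤-trans (Max-ub f j) (≤-reflexive Max≡c)) (c≤f j))
  (λ f≡c → ≤-antisym (Max-lub (≤-reflexive ∘ f≡c)) (≤-trans (≤-reflexive (sym (f≡c fz))) (Max-ub f fz)))

∃⇒or-tabulate : ∀ {p} (g : Fin p → Bool) m → g m ≡ true → foldr′ _∨_ false (tabulate g) ≡ true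
∃⇒or-tabulate g fz     gm≡true rewrite gm≡true = refl
∃⇒or-tabulate g (fs m) gm≡true rewrite ∃⇒or-tabulate (g ∘ fs) m gm≡true = ∨-zeroʳ (g fz)

or-tabulate⇒∃ : ∀ {p} (g : Fin p → Bool) → foldr′ _∨_ false (tabulate g) ≡ true → ∃ λ m → g m ≡ true
or-tabulate⇒∃ {suc p} g or≡true with g fz in g₀≡true
... | true  = fz , g₀≡true
... | false with or-tabulate⇒∃ (g ∘ fs) or≡true
...   | m , gm≡true = fs m , gm≡true

∧≡true⇒ : ∀ {a b : Bool} → (a ∧ b) ≡ true → a ≡ true × b ≡ true
∧≡true⇒ {true} {true} refl = refl , refl

≢⇒1<p : ∀ {p} {i j : Fin p} → ¬ i ≡ j → 1 < p
≢⇒1<p {suc zero}    {fz} {fz} i≢j = contradiction refl i≢j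
≢⇒1<p {suc (suc p)}           _   = s≤s (s≤s z≤n)

module _ {p : ℕ} (G : Graph p) where

  search≤ : ∀ n (f : ℕ → Bool) l → f l ≡ true → search G n f ≤ l
  search≤ zero    f l fl≡true = z≤n
  search≤ (suc n) f l fl≡true with f 0 in f0≡
  ... | true = z≤n
  search≤ (suc n) f zero    fl≡true | false = contradiction (trans (sym fl≡true) f0≡) λ ()
  search≤ (suc n) f (suc l) fl≡true | false = s≤s (search≤ n (f ∘ suc) l fl≡true)

  search-hit : ∀ n (f : ℕ → Bool) {k} → search G n f ≡ k → k < n → f k ≡ true
  search-hit (suc n) f s≡k k<n with f 0 in f0≡
  search-hit (suc n) f refl k<n       | true  = f0≡
  search-hit (suc n) f refl (s≤s k<n) | false = search-hit n (f ∘ suc) refl k<n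

  walk-zero⇒≡ : ∀ i j → walk G 0 i j ≡ true → i ≡ j
  walk-zero⇒≡ i j w with i ≟ j
  ... | yes i≡j = i≡j

  walk-zero-refl : ∀ i → walk G 0 i i ≡ true
  walk-zero-refl i with i ≟ i
  ... | yes _  = refl
  ... | no i≢i = contradiction refl i≢i

  walk-step : ∀ k i m j → walk G k i m ≡ true → adj G m j ≡ true → walk G (suc k) i j ≡ true
  walk-step k i m j w a =
    trans (cong (walk G k i j ∨_) (∃⇒or-tabulate (λ m → walk G k i m ∧ adj G m j) m (cong₂ _∧_ w a)))
          (∨-zeroʳ _)

  walk-suc⁻ : ∀ k i j → walk G (suc k) i j ≡ true →
    walk G k i j ≡ true ⊎ ∃ λ m → walk G k i m ≡ true × adj G m j ≡ true
  walk-suc⁻ k i j w with walk G k i j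
  ... | true  = inj₁ refl
  ... | false with or-tabulate⇒∃ (λ m → walk G k i m ∧ adj G m j) w
  ...   | m , wa = inj₂ (m , ∧≡true⇒ wa)

  walk-one⁻ : ∀ i j → walk G 1 i j ≡ true → i ≡ j ⊎ adj G i j ≡ true
  walk-one⁻ i j w with walk-suc⁻ 0 i j w
  ... | inj₁ w₀ = inj₁ (walk-zero⇒≡ i j w₀)
  ... | inj₂ (m , w₀ , a) with walk-zero⇒≡ i m w₀
  ...   | refl = inj₂ a

  dist≤ : ∀ k i j → walk G k i j ≡ true → dist G i j ≤ k
  dist≤ k i j = search≤ p (λ l → walk G l i j) k

  dist-walk : ∀ {i j k} → dist G i j ≡ k → k < p → walk G k i j ≡ true
  dist-walk {i} {j} = search-hit p (λ l → walk G l i j)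

  dist-refl : ∀ i → dist G i i ≡ 0
  dist-refl i = n≤0⇒n≡0 (dist≤ 0 i i (walk-zero-refl i))

  dist≡0⇒≡ : ∀ {i j} → dist G i j ≡ 0 → i ≡ j
  dist≡0⇒≡ {i} {j} d≡0 = walk-zero⇒≡ i j (dist-walk d≡0 (>-nonZero⁻¹ p {{nonZeroIndex i}}))

  adj⇒dist≡1 : ∀ {i j} → adj G i j ≡ true → dist G i j ≡ 1
  adj⇒dist≡1 {i} {j} a = ≤-antisym (dist≤ 1 i j (walk-step 0 i i j (walk-zero-refl i) a)) (n≢0⇒n>0 d≢0)
    where
    d≢0 : ¬ dist G i j ≡ 0
    d≢0 d≡0 with dist≡0⇒≡ d≡0
    ... | refl = contradiction (trans (sym a) (irrefl G i)) λ ()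

  dist≡1⇒adj : ∀ {i j} → ¬ i ≡ j → dist G i j ≡ 1 → adj G i j ≡ true
  dist≡1⇒adj {i} {j} i≢j d≡1 with walk-one⁻ i j (dist-walk d≡1 (≢⇒1<p i≢j))
  ... | inj₁ i≡j = contradiction i≡j i≢j
  ... | inj₂ a   = a

  dist≡2 : ∀ {i j} → ¬ i ≡ j → adj G i j ≡ false → dist G i j ≤ 2 → dist G i j ≡ 2
  dist≡2 {i} {j} i≢j ¬a d≤2 with dist G i j in d≡
  ... | 0 = contradiction (dist≡0⇒≡ d≡) i≢j
  ... | 1 = contradiction (trans (sym ¬a) (dist≡1⇒adj i≢j d≡)) λ ()
  ... | 2 = refl
  ... | suc (suc (suc _)) with d≤2
  ...   | s≤s (s≤s ())

  walk⇒nonadjacent-within-two : ∀ k i j → ¬ i ≡ j → adj G i j ≡ false → walk G k i j ≡ true →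
    ∃ λ x → ¬ i ≡ x × adj G i x ≡ false × walk G 2 i x ≡ true
  walk⇒nonadjacent-within-two zero    i j i≢j ¬a w = contradiction (walk-zero⇒≡ i j w) i≢j
  walk⇒nonadjacent-within-two (suc k) i j i≢j ¬a w with walk-suc⁻ k i j w
  ... | inj₁ w′ = walk⇒nonadjacent-within-two k i j i≢j ¬a w′
  ... | inj₂ (m , w′ , am) with i ≟ m
  ...   | yes refl = contradiction (trans (sym ¬a) am) λ ()
  ...   | no i≢m with adj G i m in aim
  ...     | true  = j , i≢j , ¬a , walk-step 1 i m j (walk-step 0 i i m (walk-zero-refl i) aim) am
  ...     | false = walk⇒nonadjacent-within-two k i m i≢m aim w′

  1<dist⇒≢ : ∀ {i j} → 1 < dist G i j → ¬ i ≡ j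
  1<dist⇒≢ {i} 1<d refl = contradiction (subst (1 <_) (dist-refl i) 1<d) λ ()

  1<dist⇒¬adj : ∀ {i j} → 1 < dist G i j → adj G i j ≡ false
  1<dist⇒¬adj {i} {j} 1<d with adj G i j in a
  ... | true  = contradiction (subst (1 <_) (adj⇒dist≡1 a) 1<d) (n≮n 1)
  ... | false = refl

  ∃dist≡2 : Connected G → ∀ {i} → 1 < ecc G i → ∃ λ x → dist G i x ≡ 2
  ∃dist≡2 conn {i} 1<ecc with <Max⇒∃< (dist G i) 1<ecc
  ... | j , 1<d with conn i j
  ...   | k , w with walk⇒nonadjacent-within-two k i j (1<dist⇒≢ 1<d) (1<dist⇒¬adj 1<d) w
  ...     | x , i≢x , ¬a , w₂ = x , dist≡2 i≢x ¬a (dist≤ 2 i x w₂)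

  εM-cases : ∀ i j → εM G i j ≡ 0 ⊎ (εM G i j ≡ dist G i j × dist G i j ≡ ecc G i ⊓ ecc G j)
  εM-cases i j with dist G i j ≡ᵇ (ecc G i ⊓ ecc G j) in d≡ᵇ
  ... | true  = inj₂ (refl , ≡ᵇ⇒≡ _ _ (subst T (sym d≡ᵇ) tt))
  ... | false = inj₁ refl

  εM-at-min : ∀ {i j} → dist G i j ≡ ecc G i ⊓ ecc G j → εM G i j ≡ dist G i j
  εM-at-min {i} {j} d≡min with dist G i j ≡ᵇ (ecc G i ⊓ ecc G j) | ≡⇒≡ᵇ _ _ d≡min
  ... | true | _ = refl

  0<εM⇒εM≡dist : ∀ {i j} → 0 < εM G i j → εM G i j ≡ dist G i j
  0<εM⇒εM≡dist {i} {j} 0<εM with εM-cases i j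
  ... | inj₁ εM≡0      = contradiction εM≡0 (n>0⇒n≢0 0<εM)
  ... | inj₂ (εM≡d , _) = εM≡d

  εM≤ecc : ∀ i j → εM G i j ≤ ecc G i
  εM≤ecc i j with εM-cases i j
  ... | inj₁ εM≡0         = ≤-trans (≤-reflexive εM≡0) z≤n
  ... | inj₂ (εM≡d , d≡min) = ≤-trans (≤-reflexive (trans εM≡d d≡min)) (m⊓n≤m _ _)

  εM-diag : ∀ i → εM G i i ≡ 0
  εM-diag i with εM-cases i i
  ... | inj₁ εM≡0      = εM≡0
  ... | inj₂ (εM≡d , _) = trans εM≡d (dist-refl i)

  εζ-entry : Fin p → Fin p → ℕ
  εζ-entry i j = εM G i j + (if adj G i j then 1 else 0) * ecc G i

  ecc-entry : Fin p → Fin p → ℕ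
  ecc-entry i j = (if ⌊ i ≟ j ⌋ then 0 else 1) * ecc G i

  Σ-εζ-entry : twiceWε G + ζ G ≡ Σ[ (λ i → Σ[ εζ-entry i ]) ]
  Σ-εζ-entry = begin
    twiceWε G + ζ G
      ≡⟨ Σ-distrib-+ (λ i → Σ[ εM G i ]) (λ i → deg G i * ecc G i) ⟨
    Σ[ (λ i → Σ[ εM G i ] + deg G i * ecc G i) ]
      ≡⟨ Σ-cong (λ i → cong (Σ[ εM G i ] +_) (*-distribʳ-Σ (ecc G i) (λ j → if adj G i j then 1 else 0))) ⟩
    Σ[ (λ i → Σ[ εM G i ] + Σ[ (λ j → (if adj G i j then 1 else 0) * ecc G i) ]) ]
      ≡⟨ Σ-cong (λ i → Σ-distrib-+ (εM G i) (λ j → (if adj G i j then 1 else 0) * ecc G i)) ⟨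
    Σ[ (λ i → Σ[ εζ-entry i ]) ]
      ∎
    where open ≡-Reasoning

  Σ-ecc-entry : (p ∸ 1) * totalEcc G ≡ Σ[ (λ i → Σ[ ecc-entry i ]) ]
  Σ-ecc-entry = begin
    (p ∸ 1) * totalEcc G
      ≡⟨ *-distribˡ-Σ (p ∸ 1) (ecc G) ⟩
    Σ[ (λ i → (p ∸ 1) * ecc G i) ]
      ≡⟨ Σ-cong (λ i → cong (_* ecc G i) (Σ-≢ i)) ⟨
    Σ[ (λ i → Σ[ (λ j → if ⌊ i ≟ j ⌋ then 0 else 1) ] * ecc G i) ]
      ≡⟨ Σ-cong (λ i → *-distribʳ-Σ (ecc G i) (λ j → if ⌊ i ≟ j ⌋ then 0 else 1)) ⟩
    Σ[ (λ i → Σ[ ecc-entry i ]) ]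
      ∎
    where open ≡-Reasoning

  εζ-entry-diag : ∀ i → εζ-entry i i ≡ 0
  εζ-entry-diag i rewrite εM-diag i | irrefl G i = refl

  entries-nonadjacent : ∀ {i j} → ¬ i ≡ j → adj G i j ≡ false →
    εζ-entry i j ≡ εM G i j × ecc-entry i j ≡ ecc G i
  entries-nonadjacent {i} {j} i≢j ¬a with i ≟ j
  ... | yes i≡j = contradiction i≡j i≢j
  ... | no _ rewrite ¬a = +-identityʳ _ , +-identityʳ _

module _ {p : ℕ} (G : Graph p) (ecc>1 : ∀ i → 1 < ecc G i) where

  εM-adj : ∀ {i j} → adj G i j ≡ true → εM G i j ≡ 0
  εM-adj {i} {j} a with εM-cases G i j
  ... | inj₁ εM≡0         = εM≡0
  ... | inj₂ (_ , d≡min) =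
    contradiction (subst (1 <_) (trans (sym d≡min) (adj⇒dist≡1 G a)) (⊓-glb (ecc>1 i) (ecc>1 j))) (n≮n 1)

  εζ-entry≤ecc-entry : ∀ i j → εζ-entry G i j ≤ ecc-entry G i j
  εζ-entry≤ecc-entry i j with i ≟ j
  ... | yes refl = ≤-reflexive (εζ-entry-diag G i)
  ... | no _ with adj G i j in a
  ...   | true  = ≤-reflexive (cong (_+ _) (εM-adj a))
  ...   | false = +-monoˡ-≤ 0 (εM≤ecc G i j)

  twiceWε+ζ≤ : twiceWε G + ζ G ≤ (p ∸ 1) * totalEcc G
  twiceWε+ζ≤ = begin
    twiceWε G + ζ G                        ≡⟨ Σ-εζ-entry G ⟩
    Σ[ (λ i → Σ[ εζ-entry G i ]) ]         ≤⟨ Σ-mono-≤ (λ i → Σ-mono-≤ (εζ-entry≤ecc-entry i)) ⟩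
    Σ[ (λ i → Σ[ ecc-entry G i ]) ]        ≡⟨ Σ-ecc-entry G ⟨
    (p ∸ 1) * totalEcc G                   ∎
    where open ≤-Reasoning

  ≡⇒entries-equal : twiceWε G + ζ G ≡ (p ∸ 1) * totalEcc G → ∀ i j → εζ-entry G i j ≡ ecc-entry G i j
  ≡⇒entries-equal eq i = Σ-rigid (εζ-entry≤ecc-entry i) (Σ-rigid row-sums≤ ΣΣ≡ i)
    where
    row-sums≤ : ∀ i → Σ[ εζ-entry G i ] ≤ Σ[ ecc-entry G i ]
    row-sums≤ i = Σ-mono-≤ (εζ-entry≤ecc-entry i)
    ΣΣ≡ : Σ[ (λ i → Σ[ εζ-entry G i ]) ] ≡ Σ[ (λ i → Σ[ ecc-entry G i ]) ]
    ΣΣ≡ = trans (sym (Σ-εζ-entry G)) (trans eq (Σ-ecc-entry G))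

  entries-equal⇒ecc≡2 : Connected G → (∀ i j → εζ-entry G i j ≡ ecc-entry G i j) → ∀ i → ecc G i ≡ 2
  entries-equal⇒ecc≡2 conn entries≡ i with ∃dist≡2 G conn (ecc>1 i)
  ... | x , d≡2 = begin
    ecc G i      ≡⟨ εM≡ecc ⟨
    εM G i x     ≡⟨ 0<εM⇒εM≡dist G (subst (0 <_) (sym εM≡ecc) (<⇒≤ (ecc>1 i))) ⟩
    dist G i x   ≡⟨ d≡2 ⟩
    2            ∎
    where
    open ≡-Reasoning
    1<d : 1 < dist G i x
    1<d = ≤-reflexive (sym d≡2)
    εM≡ecc : εM G i x ≡ ecc G i
    εM≡ecc with entries-nonadjacent G (1<dist⇒≢ G 1<d) (1<dist⇒¬adj G 1<d)
    ... | εζ≡εM , ecc-entry≡ecc = trans (sym εζ≡εM) (trans (entries≡ i x) ecc-entry≡ecc)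

  ecc≡2⇒entries-equal : (∀ i → ecc G i ≡ 2) → ∀ i j → εζ-entry G i j ≡ ecc-entry G i j
  ecc≡2⇒entries-equal ecc≡2 i j with i ≟ j
  ... | yes refl = εζ-entry-diag G i
  ... | no i≢j with adj G i j in a
  ...   | true  = cong (_+ _) (εM-adj a)
  ...   | false = cong (_+ 0) (begin
    εM G i j    ≡⟨ εM-at-min G (trans d≡2 (sym (cong₂ _⊓_ (ecc≡2 i) (ecc≡2 j)))) ⟩
    dist G i j  ≡⟨ d≡2 ⟩
    2           ≡⟨ ecc≡2 i ⟨
    ecc G i     ∎)
    where
    open ≡-Reasoning
    d≡2 : dist G i j ≡ 2
    d≡2 = dist≡2 G i≢j a (≤-trans (Max-ub (dist G i) j) (≤-reflexive (ecc≡2 i)))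

  entries-equal⇒≡ : (∀ i j → εζ-entry G i j ≡ ecc-entry G i j) → twiceWε G + ζ G ≡ (p ∸ 1) * totalEcc G
  entries-equal⇒≡ entries≡ =
    trans (Σ-εζ-entry G) (trans (Σ-cong (λ i → Σ-cong (entries≡ i))) (sym (Σ-ecc-entry G)))

theorem4p5 : (p : ℕ) → 1 ≤ p → (G : Graph p) → Connected G →
    (∀ i → 1 < ecc G i) →
    (twiceWε G + ζ G ≤ (p ∸ 1) * totalEcc G)
    × ((twiceWε G + ζ G ≡ (p ∸ 1) * totalEcc G) ⇔ (diam G ≡ 2))
theorem4p5 zero    () G conn ecc>1
theorem4p5 (suc n) _  G conn ecc>1 = twiceWε+ζ≤ G ecc>1 , mk⇔
  (λ eq → from (entries-equal⇒ecc≡2 G ecc>1 conn (≡⇒entries-equal G ecc>1 eq)))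
  (λ diam≡2 → entries-equal⇒≡ G ecc>1 (ecc≡2⇒entries-equal G ecc>1 (to diam≡2)))
  where open Equivalence (Max≡⇔≡ ecc>1)
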